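{- Let $H_1$ and $H_2$ be loopless graphs (parallel edges allowed) with $V(H_1)\cap V(H_2)=\{v_1,v_2\}$ and disjoint edge sets, and let $G=H_1\cup H_2$. For $i=1,2$ let $G_i$ be the graph obtained from $H_i$ by adding one new edge joining $v_1$ and $v_2$. Suppose that $G$, $G_1$, $G_2$ are connected and that for each $G^*\in\{G,G_1,G_2\}$ we have $2|V(G^*)|=|E(G^*)|+2$. Then the graph permanent of $G$ equals the product of the graph permanents of $G_1$ and $G_2$ (modulo $3$).
   Context: Given a graph $H$ with an arbitrary orientation, its signed incidence matrix has rows indexed by vertices and columns by edges, entry $1$ at the tail, $-1$ at the head, $0$ otherwise; deleting the row of a chosen special vertex and stacking $2$ copies vertically gives a $2$DSI matrix. For $|E(H)|=2(|V(H)|-1)$, the graph permanent of $H$ is $\pm\mathrm{Perm}(M)\bmod 3$ for a $2$DSI matrix $M$ of $H$, taken as a residue in $\{0,1\}$; it is independent of the choices made. Here $\mathrm{Perm}(A)=\sum_{\sigma}\prod_i a_{i,\sigma(i)}$. -}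

module Defs where

open import Data.Nat using (ℕ; zero; suc; _+_; _*_)
open import Data.Integer as ℤ using (ℤ; +_; -_)
open import Data.Integer.DivMod using (_%ℕ_)
open import Data.Fin using (Fin; _≟_)
open import Data.Product using (_×_; _,_; proj₁; proj₂)
open import Data.List using (List; []; _∷_; map; concatMap; zipWith; foldr; filter; length; _++_)
open import Data.List.Membership.Propositional using (_∈_)
open import Data.List.Relation.Unary.Unique.Propositional using (Unique)
open import Relation.Nullary using (¬_; yes; no)
open import Relation.Nullary.Decidable using (¬?)
open import Relation.Binary.PropositionalEquality using (_≡_)

insertions : {A : Set} → A → List A → List (List A)
insertions x []       = (x ∷ []) ∷ []
insertions x (y ∷ ys) = (x ∷ y ∷ ys) ∷ map (y ∷_) (insertions x ys)

-- all k! orderings of a list of length k (counted with multiplicity)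
perms : {A : Set} → List A → List (List A)
perms []       = [] ∷ []
perms (x ∷ xs) = concatMap (insertions x) (perms xs)

sumℤ : List ℤ → ℤ
sumℤ = foldr ℤ._+_ (+ 0)

prodℤ : List ℤ → ℤ
prodℤ = foldr ℤ._*_ (+ 1)

Perm : {R C : Set} → (R → C → ℤ) → List R → List C → ℤ
Perm a rows cols = sumℤ (map (λ cs → prodℤ (zipWith a rows cs)) (perms cols))

-- A graph is a list of vertices
-- and a list of edges; an edge is an ordered pair (tail , head), which
-- simultaneously fixes an (arbitrary) orientation.  Parallel edges are
-- allowed (repeated list entries are distinct edges).

Edge : ℕ → Set
Edge n = Fin n × Fin n

record IsLooplessGraph {n : ℕ} (vs : List (Fin n)) (es : List (Edge n)) : Set where
  field
    uniqueV  : Unique vs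
    tail∈    : ∀ {e} → e ∈ es → proj₁ e ∈ vs
    head∈    : ∀ {e} → e ∈ es → proj₂ e ∈ vs
    loopless : ∀ {e} → e ∈ es → ¬ (proj₁ e ≡ proj₂ e)

data Reach {n : ℕ} (es : List (Edge n)) : Fin n → Fin n → Set where
  here    : ∀ {u} → Reach es u u
  forward : ∀ {u v w} → (u , v) ∈ es → Reach es v w → Reach es u w
  back    : ∀ {u v w} → (v , u) ∈ es → Reach es v w → Reach es u w

Connected : {n : ℕ} → List (Fin n) → List (Edge n) → Set
Connected vs es = ∀ {u w} → u ∈ vs → w ∈ vs → Reach es u w

incidence : {n : ℕ} → Fin n → Edge n → ℤ
incidence v (t , h) with v ≟ t | v ≟ h
... | yes _ | _     = + 1
... | no _  | yes _ = - (+ 1)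
... | no _  | no _  = + 0

dsiRows : {n : ℕ} → List (Fin n) → Fin n → List (Fin n)
dsiRows vs s = let r = filter (λ v → ¬? (v ≟ s)) vs in r ++ r

perm2DSI : {n : ℕ} → List (Fin n) → List (Edge n) → Fin n → ℤ
perm2DSI vs es s = Perm incidence (dsiRows vs s) es

-- graph permanent: ±Perm(M) mod 3 taken as a residue in {0,1}
-- (i.e. 0 if Perm(M) ≡ 0 mod 3, and 1 otherwise)
graphPermanent : {n : ℕ} → List (Fin n) → List (Edge n) → Fin n → ℕ
graphPermanent vs es s with perm2DSI vs es s %ℕ 3
... | zero  = 0
... | suc _ = 1

module Submission where

-- The permanent of a 2DSI matrix only depends on how often each vertex
-- occurs as a row.  We therefore work with the multiset permanent
-- mperm m E (rows = vertices with multiplicity m, columns = edges E),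
-- which satisfies the column recursion
--   mperm m ((t , h) ∷ E) = m t · mperm (m ⊖ t) E − m h · mperm (m ⊖ h) E.

open import Defs
open import Function.Base using (_∘_)
open import Function.Bundles using (_⇔_; Equivalence)
open import Data.Empty using (⊥-elim)
open import Data.Product using (_×_; _,_; proj₁; proj₂; Σ)
open import Data.Sum using (_⊎_; inj₁; inj₂; [_,_]′)
open import Relation.Nullary using (¬_; yes; no; Dec)
open import Relation.Nullary.Decidable using (¬?; _×-dec_; from-yes)
open import Relation.Binary.PropositionalEquality
open import Data.Nat as ℕ using (ℕ; zero; suc)
import Data.Nat.Properties as ℕP
import Data.Nat.Tactic.RingSolver as ℕSolver
import Data.Nat.DivMod as ℕDivMod
import Data.Nat.Divisibility as ℕDiv
open import Data.Nat.Primality using (prime?; euclidsLemma)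
import Data.Integer.Properties as ℤP
open import Data.Integer.Tactic.RingSolver using (solve-∀)
open import Data.Integer.Divisibility.Signed
  using (_∣_; _∣?_; divides; ∣m∣n⇒∣m+n; ∣m∣n⇒∣m-n; ∣m+n∣m⇒∣n; ∣n⇒∣m*n; ∣m⇒∣m*n; ∣m⇒∣-m; ∣-refl; ∣⇒∣ᵤ; ∣ᵤ⇒∣)
open import Data.Integer.DivMod using (_%ℕ_; _/ℕ_; a≡a%ℕn+[a/ℕn]*n; n%ℕd<d)
open import Data.Fin using (Fin; _≟_) renaming (zero to fzero; suc to fsuc)
import Data.Fin.Properties as FinP
open import Data.List using (List; []; _∷_; map; concatMap; zipWith; filter; length; _++_; allFin)
import Data.List.Properties as LP
open import Data.List.Relation.Unary.All as All using (All; []; _∷_)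
import Data.List.Relation.Unary.All.Properties as AllP
open import Data.List.Relation.Unary.Any using (here; there; any?)
open import Data.List.Relation.Unary.AllPairs using (_∷_)
open import Data.List.Relation.Unary.Unique.Propositional using (Unique)
import Data.List.Relation.Unary.Unique.Propositional.Properties as UniqueP
open import Data.List.Membership.Propositional using (_∈_)
open import Data.List.Membership.Propositional.Properties using (∈-allFin; ∈-++⁻; ∈-filter⁺)
import Algebra.Properties.Semiring.Sum as SemiringSum
import Algebra.Properties.CommutativeSemigroup as CommSemigroupProperties

module _ where
  open import Data.Integer as ℤ using (ℤ; +_; -_; _+_; _-_; _*_)

  private
    variable
      n : ℕ

  module ℤΣ = SemiringSum ℤP.+-*-semiring
  module ℕΣ = SemiringSum ℕP.+-*-semiring
  module ℕ+ = CommSemigroupProperties ℕP.+-commutativeSemigroup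

  δ : Fin n → Fin n → ℕ
  δ x u with x ≟ u
  ... | yes _ = 1
  ... | no  _ = 0

  δ-same : (x : Fin n) → δ x x ≡ 1
  δ-same x with x ≟ x
  ... | yes _ = refl
  ... | no x≢x = ⊥-elim (x≢x refl)

  δ-diff : {x u : Fin n} → ¬ x ≡ u → δ x u ≡ 0
  δ-diff {x = x} {u} x≢u with x ≟ u
  ... | yes x≡u = ⊥-elim (x≢u x≡u)
  ... | no  _   = refl

  δ-suc : (x u : Fin n) → δ (fsuc x) (fsuc u) ≡ δ x u
  δ-suc x u = by-cases (x ≟ u)
    where
      by-cases : Dec (x ≡ u) → δ (fsuc x) (fsuc u) ≡ δ x u
      by-cases (yes refl) = trans (δ-same (fsuc x)) (sym (δ-same x))
      by-cases (no x≢u)   = trans (δ-diff (λ e → x≢u (FinP.suc-injective e))) (sym (δ-diff x≢u))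

  ∑-zero : {f : Fin n → ℤ} → (∀ v → f v ≡ + 0) → ℤΣ.sum f ≡ + 0
  ∑-zero {n = n} f≡0 = trans (ℤΣ.sum-cong-≗ f≡0) (ℤΣ.sum-replicate-zero n)

  ∑-select : (x : Fin n) (g : Fin n → ℤ) → ℤΣ.sum (λ v → + δ v x * g v) ≡ g x
  ∑-select {n = suc n} fzero g = begin
      + δ (fzero {n}) fzero * g fzero + ℤΣ.sum (λ v → + δ (fsuc v) fzero * g (fsuc v))
    ≡⟨ cong₂ (λ d s → + d * g fzero + s) (δ-same (fzero {n})) (∑-zero (λ v → cong (λ d → + d * g (fsuc v)) (δ-diff {x = fsuc v} {u = fzero} λ ()))) ⟩
      + 1 * g fzero + + 0
    ≡⟨ trans (ℤP.+-identityʳ _) (ℤP.*-identityˡ _) ⟩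
      g fzero
    ∎
    where open ≡-Reasoning
  ∑-select {n = suc n} (fsuc x) g = begin
      + δ fzero (fsuc x) * g fzero + ℤΣ.sum (λ v → + δ (fsuc v) (fsuc x) * g (fsuc v))
    ≡⟨ cong₂ (λ d s → + d * g fzero + s) (δ-diff {x = fzero} {u = fsuc x} λ ()) (ℤΣ.sum-cong-≗ (λ v → cong (λ d → + d * g (fsuc v)) (δ-suc v x))) ⟩
      + 0 + ℤΣ.sum (λ v → + δ v x * g (fsuc v))
    ≡⟨ trans (ℤP.+-identityˡ _) (∑-select x (λ v → g (fsuc v))) ⟩
      g (fsuc x)
    ∎
    where open ≡-Reasoning

  ∑-distrib-− : (f g : Fin n → ℤ) → ℤΣ.sum (λ v → f v - g v) ≡ ℤΣ.sum f - ℤΣ.sum g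
  ∑-distrib-− {n = zero}  f g = refl
  ∑-distrib-− {n = suc n} f g =
    trans (cong (λ s → f fzero - g fzero + s) (∑-distrib-− (λ v → f (fsuc v)) (λ v → g (fsuc v))))
          (regroup (f fzero) (g fzero) _ _)
    where
      regroup : ∀ a b c d → a - b + (c - d) ≡ a + c - (b + d)
      regroup = solve-∀

  -- A row multiset of vertices is a multiplicity function m : Fin n → ℕ.
  -- m ⊖ x removes one copy of x, m ⊕ x adds one.
  infixl 6 _⊖_ _⊕_

  _⊖_ : (Fin n → ℕ) → Fin n → Fin n → ℕ
  (m ⊖ x) u = m u ℕ.∸ δ x u

  _⊕_ : (Fin n → ℕ) → Fin n → Fin n → ℕ
  (m ⊕ x) u = m u ℕ.+ δ x u

  ⊖-other : (m : Fin n → ℕ) {x u : Fin n} → ¬ x ≡ u → (m ⊖ x) u ≡ m u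
  ⊖-other m x≢u = cong (_ ℕ.∸_) (δ-diff x≢u)

  ⊖-absent : (m : Fin n → ℕ) (x u : Fin n) → m x ≡ 0 → (m ⊖ x) u ≡ m u
  ⊖-absent m x u mx≡0 with x ≟ u
  ... | yes refl = trans (cong (ℕ._∸ 1) mx≡0) (sym mx≡0)
  ... | no  _    = refl

  ⊕-present : (m : Fin n → ℕ) (v : Fin n) → ¬ (m ⊕ v) v ≡ 0
  ⊕-present m v e = ℕP.1+n≢0 (trans (sym (δ-same v)) (ℕP.m+n≡0⇒n≡0 (m v) e))

  ⊖-keeps-zero : (m : Fin n → ℕ) (x u : Fin n) → m u ≡ 0 → (m ⊖ x) u ≡ 0
  ⊖-keeps-zero m x u mu≡0 = trans (cong (ℕ._∸ δ x u) mu≡0) (ℕP.0∸n≡0 (δ x u))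

  ⊕⊖-cancel : (m : Fin n → ℕ) (x u : Fin n) → (m ⊕ x ⊖ x) u ≡ m u
  ⊕⊖-cancel m x u = ℕP.m+n∸n≡m (m u) (δ x u)

  ⊕⊖-comm : (m : Fin n → ℕ) (v x : Fin n) → ¬ m x ≡ 0 → ∀ u → (m ⊕ v ⊖ x) u ≡ (m ⊖ x ⊕ v) u
  ⊕⊖-comm m v x mx≢0 u = ℕP.+-∸-comm (δ v u) (δ≤ (x ≟ u))
    where
      δ≤ : Dec (x ≡ u) → δ x u ℕ.≤ m u
      δ≤ (yes refl) with m x
      ... | zero  = ⊥-elim (mx≢0 refl)
      ... | suc _ = subst (ℕ._≤ suc _) (sym (δ-same x)) (ℕ.s≤s ℕ.z≤n)
      δ≤ (no x≢u) = subst (ℕ._≤ m u) (sym (δ-diff x≢u)) ℕ.z≤n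

  -- The permanent of the empty matrix whose (zero-length) rows are given
  -- by m: it is 1 if m is the empty multiset and 0 otherwise.
  emptyPerm : (Fin n → ℕ) → ℤ
  emptyPerm m with FinP.all? (λ u → m u ℕ.≟ 0)
  ... | yes _ = + 1
  ... | no  _ = + 0

  emptyPerm-empty : (m : Fin n → ℕ) → (∀ u → m u ≡ 0) → emptyPerm m ≡ + 1
  emptyPerm-empty m m≡0 with FinP.all? (λ u → m u ℕ.≟ 0)
  ... | yes _   = refl
  ... | no  m≢0 = ⊥-elim (m≢0 m≡0)

  emptyPerm-nonempty : (m : Fin n → ℕ) (v : Fin n) → ¬ m v ≡ 0 → emptyPerm m ≡ + 0
  emptyPerm-nonempty m v mv≢0 with FinP.all? (λ u → m u ℕ.≟ 0)
  ... | yes m≡0 = ⊥-elim (mv≢0 (m≡0 v))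
  ... | no  _   = refl

  emptyPerm-cong : {m m′ : Fin n → ℕ} → (∀ u → m u ≡ m′ u) → emptyPerm m ≡ emptyPerm m′
  emptyPerm-cong {m = m} {m′} m≗m′ with FinP.all? (λ u → m u ℕ.≟ 0) | FinP.all? (λ u → m′ u ℕ.≟ 0)
  ... | yes _   | yes _    = refl
  ... | no  _   | no  _    = refl
  ... | yes m≡0 | no  m′≢0 = ⊥-elim (m′≢0 (λ u → trans (sym (m≗m′ u)) (m≡0 u)))
  ... | no  m≢0 | yes m′≡0 = ⊥-elim (m≢0 (λ u → trans (m≗m′ u) (m′≡0 u)))

  -- The multiset permanent: the permanent of the incidence matrix with row
  -- multiset m and column list es, computed by expansion along the first
  -- column (see perm-incidence below).
  mperm : (Fin n → ℕ) → List (Edge n) → ℤ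
  mperm m []             = emptyPerm m
  mperm m ((t , h) ∷ es) = + m t * mperm (m ⊖ t) es - + m h * mperm (m ⊖ h) es

  mperm-cong : {m m′ : Fin n → ℕ} (es : List (Edge n)) → (∀ u → m u ≡ m′ u) → mperm m es ≡ mperm m′ es
  mperm-cong []             m≗m′ = emptyPerm-cong m≗m′
  mperm-cong ((t , h) ∷ es) m≗m′ =
    cong₂ _-_ (cong₂ (λ k p → + k * p) (m≗m′ t) (mperm-cong es (λ u → cong (ℕ._∸ δ t u) (m≗m′ u))))
              (cong₂ (λ k p → + k * p) (m≗m′ h) (mperm-cong es (λ u → cong (ℕ._∸ δ h u) (m≗m′ u))))

  mult : List (Fin n) → Fin n → ℕ
  mult []       u = 0
  mult (r ∷ rs) u = δ r u ℕ.+ mult rs u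

  mult-++ : (xs ys : List (Fin n)) (u : Fin n) → mult (xs ++ ys) u ≡ mult xs u ℕ.+ mult ys u
  mult-++ []       ys u = refl
  mult-++ (x ∷ xs) ys u = trans (cong (δ x u ℕ.+_) (mult-++ xs ys u)) (sym (ℕP.+-assoc (δ x u) _ _))

  lsum : {X : Set} → (X → ℤ) → List X → ℤ
  lsum f xs = sumℤ (map f xs)

  lsum-cong : {X : Set} {f g : X → ℤ} (xs : List X) → All (λ x → f x ≡ g x) xs → lsum f xs ≡ lsum g xs
  lsum-cong []       []         = refl
  lsum-cong (x ∷ xs) (fx≡gx ∷ ps) = cong₂ _+_ fx≡gx (lsum-cong xs ps)

  lsum-map : {X Y : Set} (f : Y → ℤ) (g : X → Y) (xs : List X) → lsum f (map g xs) ≡ lsum (λ x → f (g x)) xs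
  lsum-map f g []       = refl
  lsum-map f g (x ∷ xs) = cong (_+_ (f (g x))) (lsum-map f g xs)

  lsum-++ : {X : Set} (f : X → ℤ) (xs ys : List X) → lsum f (xs ++ ys) ≡ lsum f xs + lsum f ys
  lsum-++ f []       ys = sym (ℤP.+-identityˡ _)
  lsum-++ f (x ∷ xs) ys = trans (cong (_+_ (f x)) (lsum-++ f xs ys)) (sym (ℤP.+-assoc (f x) _ _))

  lsum-concatMap : {X Y : Set} (f : Y → ℤ) (g : X → List Y) (xs : List X)
    → lsum f (concatMap g xs) ≡ lsum (λ x → lsum f (g x)) xs
  lsum-concatMap f g []       = refl
  lsum-concatMap f g (x ∷ xs) = trans (lsum-++ f (g x) (concatMap g xs)) (cong (_+_ (lsum f (g x))) (lsum-concatMap f g xs))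

  lsum-* : {X : Set} (k : ℤ) (f : X → ℤ) (xs : List X) → lsum (λ x → k * f x) xs ≡ k * lsum f xs
  lsum-* k f []       = sym (ℤP.*-zeroʳ k)
  lsum-* k f (x ∷ xs) = trans (cong (_+_ (k * f x)) (lsum-* k f xs)) (sym (ℤP.*-distribˡ-+ k (f x) _))

  lsum-+ : {X : Set} (f g : X → ℤ) (xs : List X) → lsum (λ x → f x + g x) xs ≡ lsum f xs + lsum g xs
  lsum-+ f g []       = refl
  lsum-+ f g (x ∷ xs) = trans (cong (_+_ (f x + g x)) (lsum-+ f g xs)) (regroup (f x) (g x) _ _)
    where
      regroup : ∀ a b c d → a + b + (c + d) ≡ a + c + (b + d)
      regroup = solve-∀

  lsum-zero : {X : Set} (xs : List X) → lsum (λ _ → + 0) xs ≡ + 0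
  lsum-zero []       = refl
  lsum-zero (x ∷ xs) = trans (ℤP.+-identityˡ _) (lsum-zero xs)

  lsum-swap : {X Y : Set} (h : X → Y → ℤ) (xs : List X) (ys : List Y)
    → lsum (λ x → lsum (h x) ys) xs ≡ lsum (λ y → lsum (λ x → h x y) xs) ys
  lsum-swap h []       ys = sym (lsum-zero ys)
  lsum-swap h (x ∷ xs) ys =
    trans (cong (_+_ (lsum (h x) ys)) (lsum-swap h xs ys)) (sym (lsum-+ (h x) (λ y → lsum (λ x → h x y) xs) ys))

  pick : {X : Set} → List X → List (X × List X)
  pick []       = []
  pick (r ∷ rs) = (r , rs) ∷ map (λ p → proj₁ p , r ∷ proj₂ p) (pick rs)

  lsum-pick : {X : Set} (g : X → ℤ) (xs : List X) → lsum (λ p → g (proj₁ p)) (pick xs) ≡ lsum g xs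
  lsum-pick g []       = refl
  lsum-pick g (r ∷ rs) = cong (_+_ (g r)) (trans (lsum-map (λ p → g (proj₁ p)) (λ p → proj₁ p , r ∷ proj₂ p) (pick rs)) (lsum-pick g rs))

  insertions-length : {C : Set} (x : C) (cs : List C) → All (λ ys → length ys ≡ suc (length cs)) (insertions x cs)
  insertions-length x []       = refl ∷ []
  insertions-length x (c ∷ cs) = refl ∷ AllP.map⁺ (All.map (cong suc) (insertions-length x cs))

  perms-length : {C : Set} (xs : List C) → All (λ cs → length cs ≡ length xs) (perms xs)
  perms-length []       = refl ∷ []
  perms-length (x ∷ xs) = AllP.concat⁺ (AllP.map⁺
    (All.map (λ {cs} cs-len → All.map (λ ys-len → trans ys-len (cong suc cs-len)) (insertions-length x cs)) (perms-length xs)))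

  -- Inserting column x at every position of cs amounts to choosing which
  -- row meets column x.
  insertions-expand : {R C : Set} (a : R → C → ℤ) (x : C) (cs : List C) (rows : List R) → length rows ≡ suc (length cs)
    → lsum (λ ys → prodℤ (zipWith a rows ys)) (insertions x cs)
      ≡ lsum (λ p → a (proj₁ p) x * prodℤ (zipWith a (proj₂ p) cs)) (pick rows)
  insertions-expand a x []       (r ∷ [])   _   = refl
  insertions-expand a x (c ∷ cs) (r ∷ rows) len =
    cong (_+_ (a r x * prodℤ (zipWith a rows (c ∷ cs)))) (begin
        lsum (λ ys → prodℤ (zipWith a (r ∷ rows) ys)) (map (c ∷_) (insertions x cs))
      ≡⟨ lsum-map _ (c ∷_) (insertions x cs) ⟩
        lsum (λ ys → a r c * prodℤ (zipWith a rows ys)) (insertions x cs)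
      ≡⟨ lsum-* (a r c) _ (insertions x cs) ⟩
        a r c * lsum (λ ys → prodℤ (zipWith a rows ys)) (insertions x cs)
      ≡⟨ cong (a r c *_) (insertions-expand a x cs rows (ℕP.suc-injective len)) ⟩
        a r c * lsum (λ p → a (proj₁ p) x * prodℤ (zipWith a (proj₂ p) cs)) (pick rows)
      ≡⟨ sym (lsum-* (a r c) _ (pick rows)) ⟩
        lsum (λ p → a r c * (a (proj₁ p) x * prodℤ (zipWith a (proj₂ p) cs))) (pick rows)
      ≡⟨ lsum-cong (pick rows) (All.universal (λ p → swap₁₂ (a r c) (a (proj₁ p) x) _) (pick rows)) ⟩
        lsum (λ p → a (proj₁ p) x * prodℤ (zipWith a (r ∷ proj₂ p) (c ∷ cs))) (pick rows)
      ≡⟨ sym (lsum-map _ (λ p → proj₁ p , r ∷ proj₂ p) (pick rows)) ⟩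
        lsum (λ p → a (proj₁ p) x * prodℤ (zipWith a (proj₂ p) (c ∷ cs))) (map (λ p → proj₁ p , r ∷ proj₂ p) (pick rows))
      ∎)
    where
      open ≡-Reasoning
      swap₁₂ : ∀ u v w → u * (v * w) ≡ v * (u * w)
      swap₁₂ = solve-∀

  perm-expand : {R C : Set} (a : R → C → ℤ) (rows : List R) (x : C) (xs : List C) → length rows ≡ suc (length xs)
    → Perm a rows (x ∷ xs) ≡ lsum (λ p → a (proj₁ p) x * Perm a (proj₂ p) xs) (pick rows)
  perm-expand a rows x xs len = begin
      lsum (λ cs → prodℤ (zipWith a rows cs)) (concatMap (insertions x) (perms xs))
    ≡⟨ lsum-concatMap _ (insertions x) (perms xs) ⟩
      lsum (λ cs → lsum (λ ys → prodℤ (zipWith a rows ys)) (insertions x cs)) (perms xs)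
    ≡⟨ lsum-cong (perms xs) (All.map (λ cs-len → insertions-expand a x _ rows (trans len (cong suc (sym cs-len)))) (perms-length xs)) ⟩
      lsum (λ cs → lsum (λ p → a (proj₁ p) x * prodℤ (zipWith a (proj₂ p) cs)) (pick rows)) (perms xs)
    ≡⟨ lsum-swap (λ cs p → a (proj₁ p) x * prodℤ (zipWith a (proj₂ p) cs)) (perms xs) (pick rows) ⟩
      lsum (λ p → lsum (λ cs → a (proj₁ p) x * prodℤ (zipWith a (proj₂ p) cs)) (perms xs)) (pick rows)
    ≡⟨ lsum-cong (pick rows) (All.universal (λ p → lsum-* (a (proj₁ p) x) _ (perms xs)) (pick rows)) ⟩
      lsum (λ p → a (proj₁ p) x * Perm a (proj₂ p) xs) (pick rows)
    ∎
    where open ≡-Reasoning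

  PickedFrom : List (Fin n) → ℕ → Fin n × List (Fin n) → Set
  PickedFrom rows k p = length (proj₂ p) ≡ k × (∀ u → mult rows u ≡ δ (proj₁ p) u ℕ.+ mult (proj₂ p) u)

  pick-mult : (r : Fin n) (rs : List (Fin n)) → All (PickedFrom (r ∷ rs) (length rs)) (pick (r ∷ rs))
  pick-mult r []         = (refl , λ u → refl) ∷ []
  pick-mult r (r′ ∷ rs′) = (refl , λ u → refl) ∷ AllP.map⁺ (All.map (λ {p} → extend {p}) (pick-mult r′ rs′))
    where
      extend : {p : Fin _ × List (Fin _)} → PickedFrom (r′ ∷ rs′) (length rs′) p
        → PickedFrom (r ∷ r′ ∷ rs′) (suc (length rs′)) (proj₁ p , r ∷ proj₂ p)
      extend {p} (len , mult≡) = cong suc len , λ u →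
        trans (cong (δ r u ℕ.+_) (mult≡ u)) (ℕ+.x∙yz≈y∙xz (δ r u) (δ (proj₁ p) u) (mult (proj₂ p) u))

  Loopless : List (Edge n) → Set
  Loopless es = All (λ e → ¬ proj₁ e ≡ proj₂ e) es

  incidence-row : (t h r : Fin n) (Y : Fin n → ℤ) → ¬ t ≡ h
    → incidence r (t , h) * Y r ≡ + δ r t * Y t - + δ r h * Y h
  incidence-row t h r Y t≢h with r ≟ t | r ≟ h
  ... | yes refl | yes refl = ⊥-elim (t≢h refl)
  ... | yes refl | no _     = at-tail (Y r) (Y h)
    where
      at-tail : ∀ a b → + 1 * a ≡ + 1 * a - + 0 * b
      at-tail = solve-∀
  ... | no _     | yes refl = at-head (Y r) (Y t)
    where
      at-head : ∀ a b → - + 1 * a ≡ + 0 * b - + 1 * a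
      at-head = solve-∀
  ... | no _     | no _     = elsewhere (Y r) (Y t) (Y h)
    where
      elsewhere : ∀ a b c → + 0 * a ≡ + 0 * b - + 0 * c
      elsewhere = solve-∀

  incidence-sum : (t h : Fin n) (Y : Fin n → ℤ) → ¬ t ≡ h → (rows : List (Fin n))
    → lsum (λ r → incidence r (t , h) * Y r) rows ≡ + mult rows t * Y t - + mult rows h * Y h
  incidence-sum t h Y t≢h [] = sym (ℤP.+-inverseʳ (+ 0))
  incidence-sum t h Y t≢h (r ∷ rows) = begin
      incidence r (t , h) * Y r + lsum (λ r → incidence r (t , h) * Y r) rows
    ≡⟨ cong₂ _+_ (incidence-row t h r Y t≢h) (incidence-sum t h Y t≢h rows) ⟩
      (+ δ r t * Y t - + δ r h * Y h) + (+ mult rows t * Y t - + mult rows h * Y h)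
    ≡⟨ collect (+ δ r t) (+ δ r h) (+ mult rows t) (+ mult rows h) (Y t) (Y h) ⟩
      (+ δ r t + + mult rows t) * Y t - (+ δ r h + + mult rows h) * Y h
    ≡⟨ sym (cong₂ (λ a b → a * Y t - b * Y h) (ℤP.pos-+ (δ r t) (mult rows t)) (ℤP.pos-+ (δ r h) (mult rows h))) ⟩
      + mult (r ∷ rows) t * Y t - + mult (r ∷ rows) h * Y h
    ∎
    where
      open ≡-Reasoning
      collect : ∀ a b c d y z → a * y - b * z + (c * y - d * z) ≡ (a + c) * y - (b + d) * z
      collect = solve-∀

  perm-incidence : (es : List (Edge n)) (rows : List (Fin n)) → Loopless es → length rows ≡ length es
    → Perm incidence rows es ≡ mperm (mult rows) es
  perm-incidence []             []         _          _   = sym (emptyPerm-empty (mult []) (λ _ → refl))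
  perm-incidence ((t , h) ∷ es) (r ∷ rs)   (t≢h ∷ ll) len = begin
      Perm incidence rows ((t , h) ∷ es)
    ≡⟨ perm-expand incidence rows (t , h) es len ⟩
      lsum (λ p → incidence (proj₁ p) (t , h) * Perm incidence (proj₂ p) es) (pick rows)
    ≡⟨ lsum-cong (pick rows) (All.map (λ {p} → minor {p}) (pick-mult r rs)) ⟩
      lsum (λ p → incidence (proj₁ p) (t , h) * mperm (mult rows ⊖ proj₁ p) es) (pick rows)
    ≡⟨ lsum-pick (λ x → incidence x (t , h) * mperm (mult rows ⊖ x) es) rows ⟩
      lsum (λ x → incidence x (t , h) * mperm (mult rows ⊖ x) es) rows
    ≡⟨ incidence-sum t h (λ x → mperm (mult rows ⊖ x) es) t≢h rows ⟩
      mperm (mult rows) ((t , h) ∷ es)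
    ∎
    where
      open ≡-Reasoning
      rows : List (Fin _)
      rows = r ∷ rs
      minor : {p : Fin _ × List (Fin _)} → PickedFrom rows (length rs) p
        → incidence (proj₁ p) (t , h) * Perm incidence (proj₂ p) es ≡ incidence (proj₁ p) (t , h) * mperm (mult rows ⊖ proj₁ p) es
      minor {p} (rest-len , mult≡) = cong (incidence (proj₁ p) (t , h) *_)
        (trans (perm-incidence es (proj₂ p) ll (trans rest-len (ℕP.suc-injective len)))
               (mperm-cong es (λ u → trans (sym (ℕP.m+n∸m≡n (δ (proj₁ p) u) (mult (proj₂ p) u))) (cong (ℕ._∸ δ (proj₁ p) u) (sym (mult≡ u))))))

  ∣-zero : {d : ℤ} → d ∣ + 0
  ∣-zero = divides (+ 0) refl

  Avoids : Fin n → List (Edge n) → Set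
  Avoids v es = All (λ e → ¬ proj₁ e ≡ v × ¬ proj₂ e ≡ v) es

  mperm-unmatched : (m : Fin n → ℕ) (v : Fin n) (es : List (Edge n)) → Avoids v es → ¬ m v ≡ 0 → mperm m es ≡ + 0
  mperm-unmatched m v []             _                     mv≢0 = emptyPerm-nonempty m v mv≢0
  mperm-unmatched m v ((t , h) ∷ es) ((t≢v , h≢v) ∷ avoids) mv≢0 = begin
      + m t * mperm (m ⊖ t) es - + m h * mperm (m ⊖ h) es
    ≡⟨ cong₂ (λ a b → + m t * a - + m h * b) (still-unmatched t≢v) (still-unmatched h≢v) ⟩
      + m t * + 0 - + m h * + 0
    ≡⟨ vanish (+ m t) (+ m h) ⟩
      + 0
    ∎
    where
      open ≡-Reasoning
      still-unmatched : {x : Fin _} → ¬ x ≡ v → mperm (m ⊖ x) es ≡ + 0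
      still-unmatched {x} x≢v = mperm-unmatched (m ⊖ x) v es avoids (λ e → mv≢0 (trans (sym (⊖-other m x≢v)) e))
      vanish : ∀ a b → a * + 0 - b * + 0 ≡ + 0
      vanish = solve-∀

  -- If a vertex v occurs at least k + 1 times as a row, every term of the
  -- permanent carries the factor (m v)!, so k + 1 divides it.
  mperm-repeated : (k : ℕ) (m : Fin n → ℕ) (v : Fin n) (es : List (Edge n)) → suc k ℕ.≤ m v → + suc k ∣ mperm m es
  mperm-repeated k m v [] k<mv = subst (+ suc k ∣_) (sym (emptyPerm-nonempty m v present)) ∣-zero
    where
      present : ¬ m v ≡ 0
      present mv≡0 with subst (suc k ℕ.≤_) mv≡0 k<mv
      ... | ()
  mperm-repeated k m v ((t , h) ∷ es) k<mv = ∣m∣n⇒∣m-n (term t) (term h)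
    where
      one-fewer : suc k ℕ.< m v → suc k ℕ.≤ (m ⊖ v) v
      one-fewer lt = subst (suc k ℕ.≤_) (trans (ℕP.pred[m∸n]≡m∸[1+n] (m v) 0) (cong (m v ℕ.∸_) (sym (δ-same v)))) (ℕP.<⇒≤pred lt)
      term : (x : Fin _) → + suc k ∣ + m x * mperm (m ⊖ x) es
      term x with x ≟ v
      ... | no x≢v   = ∣n⇒∣m*n (+ m x) (mperm-repeated k (m ⊖ x) v es (subst (suc k ℕ.≤_) (sym (⊖-other m x≢v)) k<mv))
      ... | yes refl with ℕP.m≤n⇒m<n∨m≡n k<mv
      ...   | inj₁ k<mv′ = ∣n⇒∣m*n (+ m v) (mperm-repeated k (m ⊖ v) v es (one-fewer k<mv′))
      ...   | inj₂ k≡mv  = ∣m⇒∣m*n _ (subst (λ j → + suc k ∣ + j) k≡mv ∣-refl)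

  -- The derivative identity: adding one more row v and summing over all v
  -- gives 0, because every column sums to zero over all vertices.  It is
  -- proved together with its column version: the summands of the first
  -- column expansion, summed over v, reproduce mperm α.
  mperm-derivative : (α : Fin n → ℕ) (es : List (Edge n)) → Loopless es → ℤΣ.sum (λ v → mperm (α ⊕ v) es) ≡ + 0
  mperm-derivative-column : (α : Fin n → ℕ) (x : Fin n) (es : List (Edge n)) → Loopless es
    → ℤΣ.sum (λ v → + (α ⊕ v) x * mperm (α ⊕ v ⊖ x) es) ≡ mperm α es

  mperm-derivative α [] _ = ∑-zero (λ v → emptyPerm-nonempty (α ⊕ v) v (⊕-present α v))
  mperm-derivative α ((t , h) ∷ es) (_ ∷ ll) = begin
      ℤΣ.sum (λ v → + (α ⊕ v) t * mperm (α ⊕ v ⊖ t) es - + (α ⊕ v) h * mperm (α ⊕ v ⊖ h) es)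
    ≡⟨ ∑-distrib-− (λ v → + (α ⊕ v) t * mperm (α ⊕ v ⊖ t) es) (λ v → + (α ⊕ v) h * mperm (α ⊕ v ⊖ h) es) ⟩
      ℤΣ.sum (λ v → + (α ⊕ v) t * mperm (α ⊕ v ⊖ t) es) - ℤΣ.sum (λ v → + (α ⊕ v) h * mperm (α ⊕ v ⊖ h) es)
    ≡⟨ cong₂ _-_ (mperm-derivative-column α t es ll) (mperm-derivative-column α h es ll) ⟩
      mperm α es - mperm α es
    ≡⟨ ℤP.+-inverseʳ (mperm α es) ⟩
      + 0
    ∎
    where open ≡-Reasoning

  mperm-derivative-column {n} α x es ll = begin
      ℤΣ.sum (λ v → + (α ⊕ v) x * Y v)
    ≡⟨ ℤΣ.sum-cong-≗ (λ v → trans (cong (_* Y v) (ℤP.pos-+ (α x) (δ v x))) (ℤP.*-distribʳ-+ (Y v) (+ α x) (+ δ v x))) ⟩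
      ℤΣ.sum (λ v → + α x * Y v + + δ v x * Y v)
    ≡⟨ ℤΣ.∑-distrib-+ (λ v → + α x * Y v) (λ v → + δ v x * Y v) ⟩
      ℤΣ.sum (λ v → + α x * Y v) + ℤΣ.sum (λ v → + δ v x * Y v)
    ≡⟨ cong₂ _+_ (trans (sym (ℤΣ.*-distribˡ-sum (+ α x) Y)) other-rows) (∑-select x Y) ⟩
      + 0 + Y x
    ≡⟨ ℤP.+-identityˡ (Y x) ⟩
      Y x
    ≡⟨ mperm-cong es (⊕⊖-cancel α x) ⟩
      mperm α es
    ∎
    where
      open ≡-Reasoning
      Y : Fin n → ℤ
      Y v = mperm (α ⊕ v ⊖ x) es
      -- if x occurs in α, the v-sum is the derivative identity for α ⊖ x
      other-rows : + α x * ℤΣ.sum Y ≡ + 0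
      other-rows with α x ℕ.≟ 0
      ... | yes αx≡0 = cong (_* ℤΣ.sum Y) (cong +_ αx≡0)
      ... | no  αx≢0 = trans (cong (+ α x *_) (trans (ℤΣ.sum-cong-≗ (λ v → mperm-cong es (⊕⊖-comm α v x αx≢0)))
                                                      (mperm-derivative (α ⊖ x) es ll)))
                             (ℤP.*-zeroʳ (+ α x))

  without : List (Fin n) → Fin n → List (Fin n)
  without V s = filter (λ v → ¬? (v ≟ s)) V

  dsiMult : List (Fin n) → Fin n → Fin n → ℕ
  dsiMult V s = mult (dsiRows V s)

  mult-without-self : (V : List (Fin n)) (s : Fin n) → mult (without V s) s ≡ 0
  mult-without-self []      s = refl
  mult-without-self (x ∷ V) s with x ≟ s
  ... | yes refl = mult-without-self V s
  ... | no  x≢s  = trans (cong (ℕ._+ _) (δ-diff x≢s)) (mult-without-self V s)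

  mult-without-other : (V : List (Fin n)) (s u : Fin n) → ¬ u ≡ s → mult (without V s) u ≡ mult V u
  mult-without-other []      s u _   = refl
  mult-without-other (x ∷ V) s u u≢s with x ≟ s
  ... | yes refl = trans (mult-without-other V s u u≢s) (cong (ℕ._+ _) (sym (δ-diff (≢-sym u≢s))))
  ... | no  _    = cong (δ x u ℕ.+_) (mult-without-other V s u u≢s)

  mult-absent : (V : List (Fin n)) (u : Fin n) → ¬ u ∈ V → mult V u ≡ 0
  mult-absent []      u _   = refl
  mult-absent (x ∷ V) u u∉ = trans (cong (ℕ._+ _) (δ-diff (λ x≡u → u∉ (here (sym x≡u))))) (mult-absent V u (λ p → u∉ (there p)))

  mult-unique : (V : List (Fin n)) (u : Fin n) → Unique V → u ∈ V → mult V u ≡ 1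
  mult-unique (x ∷ V) .x (x∉V ∷ _) (here refl) =
    cong₂ ℕ._+_ (δ-same x) (mult-absent V x (λ p → All.lookup x∉V p refl))
  mult-unique (x ∷ V) u (x∉V ∷ uV) (there p) =
    trans (cong (ℕ._+ _) (δ-diff (λ x≡u → All.lookup x∉V p x≡u))) (mult-unique V u uV p)

  dsiMult-special : (V : List (Fin n)) (s : Fin n) → dsiMult V s s ≡ 0
  dsiMult-special V s = trans (mult-++ (without V s) (without V s) s) (cong₂ ℕ._+_ (mult-without-self V s) (mult-without-self V s))

  dsiMult-other : (V : List (Fin n)) (s u : Fin n) → ¬ u ≡ s → dsiMult V s u ≡ mult V u ℕ.+ mult V u
  dsiMult-other V s u u≢s = trans (mult-++ (without V s) (without V s) u)
    (cong₂ ℕ._+_ (mult-without-other V s u u≢s) (mult-without-other V s u u≢s))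

  dsiMult-member : (V : List (Fin n)) (s u : Fin n) → Unique V → u ∈ V → ¬ u ≡ s → dsiMult V s u ≡ 2
  dsiMult-member V s u uV u∈ u≢s = trans (dsiMult-other V s u u≢s) (cong (λ k → k ℕ.+ k) (mult-unique V u uV u∈))

  dsiMult-absent : (V : List (Fin n)) (s u : Fin n) → ¬ u ∈ V → dsiMult V s u ≡ 0
  dsiMult-absent V s u u∉ with u ≟ s
  ... | yes refl = dsiMult-special V u
  ... | no  u≢s  = trans (dsiMult-other V s u u≢s) (cong (λ k → k ℕ.+ k) (mult-absent V u u∉))

  dsiMult-away : (V : List (Fin n)) (s s′ u : Fin n) → ¬ u ≡ s → ¬ u ≡ s′ → dsiMult V s u ≡ dsiMult V s′ u
  dsiMult-away V s s′ u u≢s u≢s′ = trans (dsiMult-other V s u u≢s) (sym (dsiMult-other V s′ u u≢s′))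

  Within : List (Fin n) → List (Edge n) → Set
  Within V E = All (λ e → proj₁ e ∈ V × proj₂ e ∈ V) E

  graph-within : {V : List (Fin n)} {E : List (Edge n)} → IsLooplessGraph V E → Within V E
  graph-within H = All.tabulate (λ e∈ → IsLooplessGraph.tail∈ H e∈ , IsLooplessGraph.head∈ H e∈)

  graph-loopless : {V : List (Fin n)} {E : List (Edge n)} → IsLooplessGraph V E → Loopless E
  graph-loopless H = All.tabulate (IsLooplessGraph.loopless H)

  within-avoids : (V : List (Fin n)) (E : List (Edge n)) (v : Fin n) → Within V E → ¬ v ∈ V → Avoids v E
  within-avoids V E v within v∉ = All.map (λ (t∈ , h∈) → (λ t≡v → v∉ (subst (_∈ V) t≡v t∈)) , (λ h≡v → v∉ (subst (_∈ V) h≡v h∈))) within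

  ∑-except-two : (d : ℤ) (f : Fin n → ℤ) (a b : Fin n) → ¬ a ≡ b → (∀ v → ¬ v ≡ a → ¬ v ≡ b → d ∣ f v)
    → d ∣ ℤΣ.sum f - f a - f b
  ∑-except-two {n} d f a b a≢b d∣f = subst (d ∣_) sum-g (∑-divisible (λ v → d∣g (v ≟ a) (v ≟ b)))
    where
      g : Fin n → ℤ
      g v = f v - + δ v a * f a - + δ v b * f b
      ∑-divisible : {n : ℕ} {h : Fin n → ℤ} → (∀ v → d ∣ h v) → d ∣ ℤΣ.sum h
      ∑-divisible {zero}  _   = ∣-zero
      ∑-divisible {suc n} d∣h = ∣m∣n⇒∣m+n (d∣h fzero) (∑-divisible (λ v → d∣h (fsuc v)))
      d∣g : {v : Fin n} → Dec (v ≡ a) → Dec (v ≡ b) → d ∣ g v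
      d∣g (yes refl) (yes refl) = ⊥-elim (a≢b refl)
      d∣g {v} (yes refl) (no v≢b) rewrite δ-same v | δ-diff v≢b = subst (d ∣_) (sym (cancel (f v) (f b))) ∣-zero
        where
          cancel : ∀ x y → x - + 1 * x - + 0 * y ≡ + 0
          cancel = solve-∀
      d∣g {v} (no v≢a) (yes refl) rewrite δ-diff v≢a | δ-same v = subst (d ∣_) (sym (cancel (f v) (f a))) ∣-zero
        where
          cancel : ∀ x y → x - + 0 * y - + 1 * x ≡ + 0
          cancel = solve-∀
      d∣g {v} (no v≢a) (no v≢b) rewrite δ-diff v≢a | δ-diff v≢b = subst (d ∣_) (sym (unchanged (f v) (f a) (f b))) (d∣f v v≢a v≢b)
        where
          unchanged : ∀ x y z → x - + 0 * y - + 0 * z ≡ x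
          unchanged = solve-∀
      sum-g : ℤΣ.sum g ≡ ℤΣ.sum f - f a - f b
      sum-g = begin
          ℤΣ.sum g
        ≡⟨ ∑-distrib-− (λ v → f v - + δ v a * f a) (λ v → + δ v b * f b) ⟩
          ℤΣ.sum (λ v → f v - + δ v a * f a) - ℤΣ.sum (λ v → + δ v b * f b)
        ≡⟨ cong₂ _-_ (∑-distrib-− f (λ v → + δ v a * f a)) (∑-select b (λ _ → f b)) ⟩
          ℤΣ.sum f - ℤΣ.sum (λ v → + δ v a * f a) - f b
        ≡⟨ cong (λ z → ℤΣ.sum f - z - f b) (∑-select a (λ _ → f a)) ⟩
          ℤΣ.sum f - f a - f b
        ∎
        where open ≡-Reasoning

  -- Apply the derivative identity
  -- to α = dsiMult V s ⊖ s′: the summand at v ∉ {s , s′} is divisible by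
  -- 3 (v ∈ V then has multiplicity 3) or vanishes (v ∉ V is unmatched),
  -- and the summand at s′ is mperm (dsiMult V s) E.
  special-exchange : (V : List (Fin n)) (E : List (Edge n)) (s s′ : Fin n) → Unique V → Within V E → Loopless E
    → s′ ∈ V → ¬ s ≡ s′ → + 3 ∣ mperm (dsiMult V s ⊖ s′ ⊕ s) E + mperm (dsiMult V s) E
  special-exchange {n} V E s s′ uV within ll s′∈ s≢s′ =
    subst (+ 3 ∣_) rearranged (∣m⇒∣-m (∑-except-two (+ 3) f s s′ s≢s′ divisible))
    where
      α : Fin n → ℕ
      α = dsiMult V s ⊖ s′
      f : Fin n → ℤ
      f v = mperm (α ⊕ v) E
      divisible : ∀ v → ¬ v ≡ s → ¬ v ≡ s′ → + 3 ∣ f v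
      divisible v v≢s v≢s′ with any? (v ≟_) V
      ... | yes v∈ = mperm-repeated 2 (α ⊕ v) v E (ℕP.≤-reflexive (sym (cong₂ ℕ._+_
                       (trans (⊖-other (dsiMult V s) (≢-sym v≢s′)) (dsiMult-member V s v uV v∈ v≢s)) (δ-same v))))
      ... | no  v∉ = subst (+ 3 ∣_) (sym (mperm-unmatched (α ⊕ v) v E (within-avoids V E v within v∉) (⊕-present α v)))
                       ∣-zero
      s′-twice : dsiMult V s s′ ≡ 2
      s′-twice = dsiMult-member V s s′ uV s′∈ (≢-sym s≢s′)
      at-s′ : f s′ ≡ mperm (dsiMult V s) E
      at-s′ = mperm-cong E (λ u → trans (sym (⊕⊖-comm (dsiMult V s) s′ s′ (λ e → ℕP.1+n≢0 (trans (sym s′-twice) e)) u))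
                                        (⊕⊖-cancel (dsiMult V s) s′ u))
      rearranged : - (ℤΣ.sum f - f s - f s′) ≡ f s + mperm (dsiMult V s) E
      rearranged rewrite mperm-derivative α E ll | at-s′ = negate (f s) (mperm (dsiMult V s) E)
        where
          negate : ∀ x y → - (+ 0 - x - y) ≡ x + y
          negate = solve-∀

  -- Both exchanges lead to the same multiset: s and s′ once, every other
  -- vertex of V twice.
  exchange-symmetric : (V : List (Fin n)) (s s′ : Fin n) → Unique V → s ∈ V → s′ ∈ V → ¬ s ≡ s′
    → ∀ u → (dsiMult V s′ ⊖ s ⊕ s′) u ≡ (dsiMult V s ⊖ s′ ⊕ s) u
  exchange-symmetric V s s′ uV s∈ s′∈ s≢s′ u with u ≟ s | u ≟ s′
  ... | yes refl | yes refl = ⊥-elim (s≢s′ refl)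
  ... | yes refl | no u≢s′
    rewrite δ-same u | δ-diff (≢-sym u≢s′) | dsiMult-special V u | dsiMult-member V s′ u uV s∈ u≢s′ = refl
  ... | no u≢s   | yes refl
    rewrite δ-same u | δ-diff (≢-sym u≢s) | dsiMult-special V u | dsiMult-member V s u uV s′∈ u≢s = refl
  ... | no u≢s   | no u≢s′
    rewrite δ-diff (≢-sym u≢s) | δ-diff (≢-sym u≢s′) | dsiMult-away V s s′ u u≢s u≢s′ = refl

  mperm-special-independent : (V : List (Fin n)) (E : List (Edge n)) (s s′ : Fin n) → Unique V → Within V E → Loopless E
    → s ∈ V → s′ ∈ V → + 3 ∣ mperm (dsiMult V s) E - mperm (dsiMult V s′) E
  mperm-special-independent V E s s′ uV within ll s∈ s′∈ with s ≟ s′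
  ... | yes refl = subst (+ 3 ∣_) (sym (ℤP.+-inverseʳ (mperm (dsiMult V s) E))) ∣-zero
  ... | no s≢s′  = subst (+ 3 ∣_) (difference X A A′) (∣m∣n⇒∣m-n to-s′ to-s)
    where
      X A A′ : ℤ
      X  = mperm (dsiMult V s ⊖ s′ ⊕ s) E
      A  = mperm (dsiMult V s) E
      A′ = mperm (dsiMult V s′) E
      to-s′ : + 3 ∣ X + A
      to-s′ = special-exchange V E s s′ uV within ll s′∈ s≢s′
      to-s : + 3 ∣ X + A′
      to-s = subst (λ z → + 3 ∣ z + A′) (mperm-cong E (exchange-symmetric V s s′ uV s∈ s′∈ s≢s′))
               (special-exchange V E s′ s uV within ll s∈ (≢-sym s≢s′))
      difference : ∀ x a b → x + a - (x + b) ≡ a - b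
      difference = solve-∀

  residue : ℤ → ℕ
  residue x with x %ℕ 3
  ... | zero  = 0
  ... | suc _ = 1

  graphPermanent-residue : (V : List (Fin n)) (E : List (Edge n)) (s : Fin n)
    → graphPermanent V E s ≡ residue (perm2DSI V E s)
  graphPermanent-residue V E s with perm2DSI V E s %ℕ 3
  ... | zero  = refl
  ... | suc _ = refl

  divisible⇒%ℕ≡0 : (x : ℤ) → + 3 ∣ x → x %ℕ 3 ≡ 0
  divisible⇒%ℕ≡0 x 3∣x = trans (sym (ℕDivMod.m<n⇒m%n≡m (n%ℕd<d x 3))) (ℕDiv.n∣m⇒m%n≡0 _ 3 (∣⇒∣ᵤ 3∣r))
    where
      x≡q3+r : x ≡ (x /ℕ 3) * + 3 + + (x %ℕ 3)
      x≡q3+r = trans (a≡a%ℕn+[a/ℕn]*n x 3) (ℤP.+-comm (+ (x %ℕ 3)) ((x /ℕ 3) * + 3))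
      3∣r : + 3 ∣ + (x %ℕ 3)
      3∣r = ∣m+n∣m⇒∣n (subst (+ 3 ∣_) x≡q3+r 3∣x) (∣n⇒∣m*n (x /ℕ 3) ∣-refl)

  %ℕ≡0⇒divisible : (x : ℤ) → x %ℕ 3 ≡ 0 → + 3 ∣ x
  %ℕ≡0⇒divisible x r≡0 =
    divides (x /ℕ 3) (trans (a≡a%ℕn+[a/ℕn]*n x 3) (trans (cong (λ r → + r + (x /ℕ 3) * + 3) r≡0) (ℤP.+-identityˡ _)))

  residue-divisible : (x : ℤ) → + 3 ∣ x → residue x ≡ 0
  residue-divisible x 3∣x with x %ℕ 3 | divisible⇒%ℕ≡0 x 3∣x
  ... | zero  | _  = refl

  residue-indivisible : (x : ℤ) → ¬ + 3 ∣ x → residue x ≡ 1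
  residue-indivisible x 3∤x with x %ℕ 3 in r≡
  ... | zero  = ⊥-elim (3∤x (%ℕ≡0⇒divisible x r≡))
  ... | suc _ = refl

  residue-cong : (x y : ℤ) → + 3 ∣ x - y → residue x ≡ residue y
  residue-cong x y 3∣x-y with + 3 ∣? y
  ... | yes 3∣y = trans (residue-divisible x (subst (+ 3 ∣_) (cancel x y) (∣m∣n⇒∣m+n 3∣x-y 3∣y))) (sym (residue-divisible y 3∣y))
    where
      cancel : ∀ a b → a - b + b ≡ a
      cancel = solve-∀
  ... | no 3∤y = trans (residue-indivisible x (λ 3∣x → 3∤y (subst (+ 3 ∣_) (cancel x y) (∣m∣n⇒∣m-n 3∣x 3∣x-y))))
                       (sym (residue-indivisible y 3∤y))
    where
      cancel : ∀ a b → a - (a - b) ≡ b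
      cancel = solve-∀

  -- Since 3 is prime, the residue is multiplicative.
  3∣-product : (x y : ℤ) → + 3 ∣ x * y → + 3 ∣ x ⊎ + 3 ∣ y
  3∣-product x y 3∣xy with euclidsLemma ℤ.∣ x ∣ ℤ.∣ y ∣ (from-yes (prime? 3)) (subst (3 ℕDiv.∣_) (ℤP.abs-* x y) (∣⇒∣ᵤ 3∣xy))
  ... | inj₁ 3∣x = inj₁ (∣ᵤ⇒∣ 3∣x)
  ... | inj₂ 3∣y = inj₂ (∣ᵤ⇒∣ 3∣y)

  residue-* : (x y : ℤ) → residue (x * y) ≡ residue x ℕ.* residue y
  residue-* x y with + 3 ∣? x | + 3 ∣? y
  ... | yes 3∣x | _ = trans (residue-divisible (x * y) (∣m⇒∣m*n y 3∣x)) (cong (ℕ._* residue y) (sym (residue-divisible x 3∣x)))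
  ... | no 3∤x | yes 3∣y = trans (residue-divisible (x * y) (∣n⇒∣m*n x 3∣y))
                                 (sym (trans (cong (residue x ℕ.*_) (residue-divisible y 3∣y)) (ℕP.*-zeroʳ (residue x))))
  ... | no 3∤x | no 3∤y = trans (residue-indivisible (x * y) 3∤xy)
                                (sym (cong₂ ℕ._*_ (residue-indivisible x 3∤x) (residue-indivisible y 3∤y)))
    where
      3∤xy : ¬ + 3 ∣ x * y
      3∤xy 3∣xy with 3∣-product x y 3∣xy
      ... | inj₁ 3∣x = 3∤x 3∣x
      ... | inj₂ 3∣y = 3∤y 3∣y

  -- Doubling does not change the residue, as 3 ∤ 2.
  residue-double : (x : ℤ) → residue (+ 2 * x) ≡ residue x
  residue-double x = trans (residue-* (+ 2) x) (ℕP.*-identityˡ (residue x))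

  residue-double-product : (a b : ℤ) → residue (+ 2 * (a * b)) ≡ residue (+ 2 * a) ℕ.* residue (+ 2 * b)
  residue-double-product a b = begin
      residue (+ 2 * (a * b))
    ≡⟨ residue-double (a * b) ⟩
      residue (a * b)
    ≡⟨ residue-* a b ⟩
      residue a ℕ.* residue b
    ≡⟨ sym (cong₂ ℕ._*_ (residue-double a) (residue-double b)) ⟩
      residue (+ 2 * a) ℕ.* residue (+ 2 * b)
    ∎
    where open ≡-Reasoning

  without-length : (V : List (Fin n)) (s : Fin n) → Unique V → s ∈ V → suc (length (without V s)) ≡ length V
  without-length (x ∷ V) s (x∉V ∷ uV) s∈ with x ≟ s | s∈
  ... | yes refl | _          = cong (suc ∘ length) (LP.filter-all (λ v → ¬? (v ≟ x)) (All.map ≢-sym x∉V))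
  ... | no  x≢s  | here s≡x   = ⊥-elim (x≢s (sym s≡x))
  ... | no  _    | there s∈V  = cong suc (without-length V s uV s∈V)

  -- A square 2DSI matrix: the hypothesis 2|V| = |E| + 2 makes the number
  -- of rows 2(|V| − 1) equal to the number of columns.
  dsiRows-length : (V : List (Fin n)) (E : List (Edge n)) (s : Fin n) → Unique V → s ∈ V
    → 2 ℕ.* length V ≡ length E ℕ.+ 2 → length (dsiRows V s) ≡ length E
  dsiRows-length V E s uV s∈ count = trans (LP.length-++ (without V s)) (halve (length (without V s)) (length E) count′)
    where
      count′ : 2 ℕ.* suc (length (without V s)) ≡ length E ℕ.+ 2
      count′ = trans (cong (2 ℕ.*_) (without-length V s uV s∈)) count
      halve : ∀ a e → 2 ℕ.* suc a ≡ e ℕ.+ 2 → a ℕ.+ a ≡ e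
      halve a e eq = ℕP.+-cancelˡ-≡ 2 _ _ (trans (double a) (trans eq (ℕP.+-comm e 2)))
        where
          double : ∀ a → 2 ℕ.+ (a ℕ.+ a) ≡ 2 ℕ.* suc a
          double = ℕSolver.solve-∀

  graphPermanent-at : (V : List (Fin n)) (E : List (Edge n)) (s t : Fin n) → IsLooplessGraph V E
    → 2 ℕ.* length V ≡ length E ℕ.+ 2 → s ∈ V → t ∈ V
    → graphPermanent V E s ≡ residue (mperm (dsiMult V t) E)
  graphPermanent-at V E s t graph count s∈ t∈ = begin
      graphPermanent V E s
    ≡⟨ graphPermanent-residue V E s ⟩
      residue (Perm incidence (dsiRows V s) E)
    ≡⟨ cong residue (perm-incidence E (dsiRows V s) (graph-loopless graph) (dsiRows-length V E s uniqueV s∈ count)) ⟩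
      residue (mperm (dsiMult V s) E)
    ≡⟨ residue-cong (mperm (dsiMult V s) E) (mperm (dsiMult V t) E) (mperm-special-independent V E s t uniqueV (graph-within graph) (graph-loopless graph) s∈ t∈) ⟩
      residue (mperm (dsiMult V t) E)
    ∎
    where
      open ≡-Reasoning
      open IsLooplessGraph graph using (uniqueV)

  add-edge : (V : List (Fin n)) (E : List (Edge n)) (v₁ v₂ : Fin n) → IsLooplessGraph V E
    → v₁ ∈ V → v₂ ∈ V → ¬ v₁ ≡ v₂ → IsLooplessGraph V ((v₁ , v₂) ∷ E)
  add-edge V E v₁ v₂ graph v₁∈ v₂∈ v₁≢v₂ = record
    { uniqueV  = uniqueV
    ; tail∈    = λ { (here refl) → v₁∈ ; (there e∈) → tail∈ e∈ }
    ; head∈    = λ { (here refl) → v₂∈ ; (there e∈) → head∈ e∈ }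
    ; loopless = λ { (here refl) → v₁≢v₂ ; (there e∈) → loopless e∈ }
    }
    where open IsLooplessGraph graph

  union-complete : (V₁ V₂ : List (Fin n)) (E₁ E₂ : List (Edge n)) → IsLooplessGraph V₁ E₁ → IsLooplessGraph V₂ E₂
    → IsLooplessGraph (allFin n) (E₁ ++ E₂)
  union-complete {n} V₁ V₂ E₁ E₂ H₁ H₂ = record
    { uniqueV  = UniqueP.allFin⁺ n
    ; tail∈    = λ _ → ∈-allFin _
    ; head∈    = λ _ → ∈-allFin _
    ; loopless = λ e∈ → [ IsLooplessGraph.loopless H₁ , IsLooplessGraph.loopless H₂ ]′ (∈-++⁻ E₁ e∈)
    }

  ∑ℕ-bump : (f g : Fin n → ℕ) (x : Fin n) → (∀ u → ¬ u ≡ x → f u ≡ g u) → suc (f x) ≡ g x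
    → suc (ℕΣ.sum f) ≡ ℕΣ.sum g
  ∑ℕ-bump {suc n} f g fzero    f≗g bump = cong₂ ℕ._+_ bump (ℕΣ.sum-cong-≗ (λ u → f≗g (fsuc u) λ ()))
  ∑ℕ-bump {suc n} f g (fsuc x) f≗g bump = trans (sym (ℕP.+-suc (f fzero) _))
    (cong₂ ℕ._+_ (f≗g fzero λ ()) (∑ℕ-bump (λ u → f (fsuc u)) (λ u → g (fsuc u)) x (λ u u≢x → f≗g (fsuc u) (λ e → u≢x (FinP.suc-injective e))) bump))

  ∑ℕ-positive : (f : Fin n → ℕ) → ¬ ℕΣ.sum f ≡ 0 → Σ (Fin n) (λ u → ¬ f u ≡ 0)
  ∑ℕ-positive {zero}  f ∑≢0 = ⊥-elim (∑≢0 refl)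
  ∑ℕ-positive {suc n} f ∑≢0 with f fzero ℕ.≟ 0
  ... | no  f0≢0 = fzero , f0≢0
  ... | yes f0≡0 with ∑ℕ-positive (λ u → f (fsuc u)) (λ ∑≡0 → ∑≢0 (cong₂ ℕ._+_ f0≡0 ∑≡0))
  ...   | u , fu≢0 = fsuc u , fu≢0

  ∑ℕ-zero⁻¹ : (f : Fin n → ℕ) → ℕΣ.sum f ≡ 0 → ∀ u → f u ≡ 0
  ∑ℕ-zero⁻¹ f ∑≡0 u with f u ℕ.≟ 0
  ... | yes fu≡0 = fu≡0
  ... | no  fu≢0 = ⊥-elim (ℕP.<⇒≢ (ℕP.<-≤-trans (ℕP.n≢0⇒n>0 fu≢0) (∑ℕ-member f u)) (sym ∑≡0))
    where
      ∑ℕ-member : {n : ℕ} (f : Fin n → ℕ) (u : Fin n) → f u ℕ.≤ ℕΣ.sum f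
      ∑ℕ-member f fzero    = ℕP.m≤m+n (f fzero) _
      ∑ℕ-member f (fsuc u) = ℕP.≤-trans (∑ℕ-member (λ v → f (fsuc v)) u) (ℕP.m≤n+m _ (f fzero))

  ∑ℕ-mult : (K : List (Fin n)) → ℕΣ.sum (mult K) ≡ length K
  ∑ℕ-mult {n} []    = ℕΣ.sum-replicate-zero n
  ∑ℕ-mult (r ∷ K) = trans (ℕΣ.∑-distrib-+ (δ r) (mult K)) (cong₂ ℕ._+_ (∑ℕ-δ r) (∑ℕ-mult K))
    where
      ∑ℕ-δ : {n : ℕ} (r : Fin n) → ℕΣ.sum (δ r) ≡ 1
      ∑ℕ-δ {suc n} fzero = cong₂ ℕ._+_ (δ-same (fzero {n})) (trans (ℕΣ.sum-cong-≗ (λ u → δ-diff {x = fzero {n}} {u = fsuc u} λ ())) (ℕΣ.sum-replicate-zero n))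
      ∑ℕ-δ {suc n} (fsuc r) = cong₂ ℕ._+_ (δ-diff {x = fsuc r} {u = fzero} λ ()) (trans (ℕΣ.sum-cong-≗ (δ-suc r)) (∑ℕ-δ r))

  -- The interior of H₁
  -- (vertices of V₁ other than v₁, v₂) is not met by the edges E₂.  A row
  -- multiset m splits into its interior part and the rest; when v₂ is not
  -- a row and the edges E₁ exactly suffice to cover the interior rows
  -- (split₀), or the interior rows and one copy of v₁ (split₁), the
  -- permanent over E₁ ++ E₂ factors accordingly.
  module TwoSum {n : ℕ} (V₁ : List (Fin n)) (v₁ v₂ : Fin n) (v₁≢v₂ : ¬ v₁ ≡ v₂) (E₂ : List (Edge n)) where

    Interior : Fin n → Set
    Interior u = u ∈ V₁ × ¬ u ≡ v₁ × ¬ u ≡ v₂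

    interior? : (u : Fin n) → Dec (Interior u)
    interior? u = any? (u ≟_) V₁ ×-dec (¬? (u ≟ v₁) ×-dec ¬? (u ≟ v₂))

    v₁-exterior : ¬ Interior v₁
    v₁-exterior (_ , v₁≢v₁ , _) = v₁≢v₁ refl

    v₂-exterior : ¬ Interior v₂
    v₂-exterior (_ , _ , v₂≢v₂) = v₂≢v₂ refl

    onInterior : Fin n → ℕ → ℕ → ℕ
    onInterior u a b with interior? u
    ... | yes _ = a
    ... | no  _ = b

    onInterior-yes : {u : Fin n} {a b : ℕ} → Interior u → onInterior u a b ≡ a
    onInterior-yes {u} int with interior? u
    ... | yes _   = refl
    ... | no  ext = ⊥-elim (ext int)

    onInterior-no : {u : Fin n} {a b : ℕ} → ¬ Interior u → onInterior u a b ≡ b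
    onInterior-no {u} ext with interior? u
    ... | yes int = ⊥-elim (ext int)
    ... | no  _   = refl

    -- the interior part of m, the rest, and the same with one copy of v₁
    -- moved from the rest to the interior part
    inside outside inside⁺ outside⁻ : (Fin n → ℕ) → Fin n → ℕ
    inside   m u = onInterior u (m u) 0
    outside  m u = onInterior u 0 (m u)
    inside⁺  m u = onInterior u (m u) (δ v₁ u)
    outside⁻ m u = onInterior u 0 (m u ℕ.∸ δ v₁ u)

    weight : (Fin n → ℕ) → ℕ
    weight m = ℕΣ.sum (inside m)

    weight-interior : (m : Fin n → ℕ) (x : Fin n) → Interior x → ¬ m x ≡ 0 → suc (weight (m ⊖ x)) ≡ weight m
    weight-interior m x int mx≢0 =
      ∑ℕ-bump (inside (m ⊖ x)) (inside m) x (λ u u≢x → cong (λ k → onInterior u k 0) (⊖-other m (≢-sym u≢x))) bump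
      where
        bump : suc (onInterior x ((m ⊖ x) x) 0) ≡ onInterior x (m x) 0
        bump rewrite onInterior-yes {a = (m ⊖ x) x} {b = 0} int | onInterior-yes {a = m x} {b = 0} int | δ-same x =
          ℕP.suc-pred (m x) ⦃ ℕ.≢-nonZero mx≢0 ⦄

    weight-exterior : (m : Fin n → ℕ) (x : Fin n) → ¬ Interior x → weight (m ⊖ x) ≡ weight m
    weight-exterior m x ext = ℕΣ.sum-cong-≗ (λ u → same u (x ≟ u))
      where
        same : ∀ u → Dec (x ≡ u) → onInterior u ((m ⊖ x) u) 0 ≡ onInterior u (m u) 0
        same u (yes refl) = trans (onInterior-no ext) (sym (onInterior-no ext))
        same u (no x≢u)   = cong (λ k → onInterior u k 0) (⊖-other m x≢u)

    weight-step : (m : Fin n → ℕ) (x : Fin n) → weight m ℕ.≤ suc (weight (m ⊖ x))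
    weight-step m x with interior? x | m x ℕ.≟ 0
    ... | _       | yes mx≡0 = ℕP.≤-trans (ℕP.≤-reflexive (ℕΣ.sum-cong-≗ (λ u → cong (λ k → onInterior u k 0) (sym (⊖-absent m x u mx≡0))))) (ℕP.n≤1+n _)
    ... | yes int | no mx≢0  = ℕP.≤-reflexive (sym (weight-interior m x int mx≢0))
    ... | no ext  | no _     = ℕP.≤-trans (ℕP.≤-reflexive (sym (weight-exterior m x ext))) (ℕP.n≤1+n _)

    inside-⊖ : (m : Fin n → ℕ) (x u : Fin n) → inside (m ⊖ x) u ≡ (inside m ⊖ x) u
    inside-⊖ m x u with interior? u
    ... | yes _ = refl
    ... | no  _ = sym (ℕP.0∸n≡0 (δ x u))

    inside⁺-⊖ : (m : Fin n → ℕ) (x u : Fin n) → Interior x → inside⁺ (m ⊖ x) u ≡ (inside⁺ m ⊖ x) u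
    inside⁺-⊖ m x u int with interior? u
    ... | yes _   = refl
    ... | no  ext = cong (δ v₁ u ℕ.∸_) (sym (δ-diff (λ x≡u → ext (subst Interior x≡u int))))

    outside-⊖ : (m : Fin n → ℕ) (x u : Fin n) → Interior x → outside (m ⊖ x) u ≡ outside m u
    outside-⊖ m x u int with interior? u
    ... | yes _   = refl
    ... | no  ext = ⊖-other m (λ x≡u → ext (subst Interior x≡u int))

    outside⁻-⊖ : (m : Fin n → ℕ) (x u : Fin n) → Interior x → outside⁻ (m ⊖ x) u ≡ outside⁻ m u
    outside⁻-⊖ m x u int with interior? u
    ... | yes _   = refl
    ... | no  ext = cong (ℕ._∸ δ v₁ u) (⊖-other m (λ x≡u → ext (subst Interior x≡u int)))

    inside-⊖v₁ : (m : Fin n → ℕ) (u : Fin n) → inside (m ⊖ v₁) u ≡ (inside⁺ m ⊖ v₁) u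
    inside-⊖v₁ m u with interior? u
    ... | yes _ = refl
    ... | no  _ = sym (ℕP.n∸n≡0 (δ v₁ u))

    outside-⊖v₁ : (m : Fin n → ℕ) (u : Fin n) → outside (m ⊖ v₁) u ≡ outside⁻ m u
    outside-⊖v₁ m u with interior? u
    ... | yes _ = refl
    ... | no  _ = refl

    data Endpoint (x : Fin n) : Set where
      interior : Interior x → Endpoint x
      at-v₁    : x ≡ v₁ → Endpoint x
      at-v₂    : x ≡ v₂ → Endpoint x

    endpoint : (x : Fin n) → x ∈ V₁ → Endpoint x
    endpoint x x∈ with x ≟ v₁ | x ≟ v₂
    ... | yes x≡v₁ | _        = at-v₁ x≡v₁
    ... | no  _    | yes x≡v₂ = at-v₂ x≡v₂
    ... | no  x≢v₁ | no  x≢v₂ = interior (x∈ , x≢v₁ , x≢v₂)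

    zero-coefficient : {a : ℕ} (X : ℤ) → a ≡ 0 → + a * X ≡ + 0
    zero-coefficient X refl = refl

    module _ (interior-avoids : ∀ u → Interior u → Avoids u E₂) where

      -- Too many interior rows: E₂ cannot meet them, so the permanent vanishes.
      overfull : (E₁ : List (Edge n)) (m : Fin n → ℕ) → length E₁ ℕ.< weight m → mperm m (E₁ ++ E₂) ≡ + 0
      overfull [] m 0<w with ∑ℕ-positive (inside m) (λ w≡0 → ℕP.<⇒≢ 0<w (sym w≡0))
      ... | u , inside≢0 with interior? u
      ...   | yes int = mperm-unmatched m u E₂ (interior-avoids u int) inside≢0
      ...   | no  _   = ⊥-elim (inside≢0 refl)
      overfull ((t , h) ∷ E₁) m lt = begin
          + m t * mperm (m ⊖ t) (E₁ ++ E₂) - + m h * mperm (m ⊖ h) (E₁ ++ E₂)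
        ≡⟨ cong₂ (λ a b → + m t * a - + m h * b) (still-overfull t) (still-overfull h) ⟩
          + m t * + 0 - + m h * + 0
        ≡⟨ vanish (+ m t) (+ m h) ⟩
          + 0
        ∎
        where
          open ≡-Reasoning
          still-overfull : (x : Fin n) → mperm (m ⊖ x) (E₁ ++ E₂) ≡ + 0
          still-overfull x = overfull E₁ (m ⊖ x) (ℕP.≤-pred (ℕP.≤-trans lt (weight-step m x)))
          vanish : ∀ a b → a * + 0 - b * + 0 ≡ + 0
          vanish = solve-∀

      split₀ : (E₁ : List (Edge n)) (m : Fin n → ℕ) → Within V₁ E₁ → m v₂ ≡ 0 → weight m ≡ length E₁
        → mperm m (E₁ ++ E₂) ≡ mperm (inside m) E₁ * mperm (outside m) E₂
      split₀ [] m _ _ w≡0 = begin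
          mperm m E₂
        ≡⟨ mperm-cong E₂ (λ u → sym (all-outside u)) ⟩
          mperm (outside m) E₂
        ≡⟨ sym (ℤP.*-identityˡ _) ⟩
          + 1 * mperm (outside m) E₂
        ≡⟨ cong (_* mperm (outside m) E₂) (sym (emptyPerm-empty (inside m) (∑ℕ-zero⁻¹ (inside m) w≡0))) ⟩
          mperm (inside m) [] * mperm (outside m) E₂
        ∎
        where
          open ≡-Reasoning
          all-outside : ∀ u → outside m u ≡ m u
          all-outside u with interior? u | ∑ℕ-zero⁻¹ (inside m) w≡0 u
          ... | yes _   | inside≡0 = sym inside≡0
          ... | no  _   | _        = refl
      split₀ ((t , h) ∷ E₁) m ((t∈ , h∈) ∷ within) mv₂≡0 w≡ =
        trans (cong₂ _-_ (term t t∈) (term h h∈))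
              (factor-right (+ inside m t * mperm (inside m ⊖ t) E₁) (+ inside m h * mperm (inside m ⊖ h) E₁) (mperm (outside m) E₂))
        where
          factor-right : ∀ a b c → a * c - b * c ≡ (a - b) * c
          factor-right = solve-∀
          term : (x : Fin n) → x ∈ V₁
            → + m x * mperm (m ⊖ x) (E₁ ++ E₂) ≡ (+ inside m x * mperm (inside m ⊖ x) E₁) * mperm (outside m) E₂
          term x x∈ with endpoint x x∈
          ... | at-v₂ refl = trans (zero-coefficient _ mv₂≡0)
                               (sym (cong (_* _) (zero-coefficient _ (onInterior-no v₂-exterior))))
          ... | at-v₁ refl = trans (cong (+ m v₁ *_) (overfull E₁ (m ⊖ v₁) (ℕP.≤-reflexive (sym (trans (weight-exterior m v₁ v₁-exterior) w≡)))))
                               (trans (ℤP.*-zeroʳ (+ m v₁)) (sym (cong (_* _) (zero-coefficient _ (onInterior-no v₁-exterior)))))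
          ... | interior int with m x ℕ.≟ 0
          ...   | yes mx≡0 = trans (zero-coefficient _ mx≡0)
                               (sym (cong (_* _) (zero-coefficient _ (trans (onInterior-yes int) mx≡0))))
          ...   | no  mx≢0 = begin
              + m x * mperm (m ⊖ x) (E₁ ++ E₂)
            ≡⟨ cong (+ m x *_) (split₀ E₁ (m ⊖ x) within (⊖-keeps-zero m x v₂ mv₂≡0)
                                  (ℕP.suc-injective (trans (weight-interior m x int mx≢0) w≡))) ⟩
              + m x * (mperm (inside (m ⊖ x)) E₁ * mperm (outside (m ⊖ x)) E₂)
            ≡⟨ cong (+ m x *_) (cong₂ _*_ (mperm-cong E₁ (inside-⊖ m x)) (mperm-cong E₂ (λ u → outside-⊖ m x u int))) ⟩
              + m x * (mperm (inside m ⊖ x) E₁ * mperm (outside m) E₂)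
            ≡⟨ sym (ℤP.*-assoc (+ m x) _ _) ⟩
              (+ m x * mperm (inside m ⊖ x) E₁) * mperm (outside m) E₂
            ≡⟨ cong (λ k → (+ k * mperm (inside m ⊖ x) E₁) * mperm (outside m) E₂) (sym (onInterior-yes int)) ⟩
              (+ inside m x * mperm (inside m ⊖ x) E₁) * mperm (outside m) E₂
            ∎
            where open ≡-Reasoning

      split₁ : (E₁ : List (Edge n)) (m : Fin n → ℕ) → Within V₁ E₁ → m v₂ ≡ 0 → suc (weight m) ≡ length E₁
        → mperm m (E₁ ++ E₂) ≡ + m v₁ * (mperm (inside⁺ m) E₁ * mperm (outside⁻ m) E₂)
      split₁ []             m _                    _      ()
      split₁ ((t , h) ∷ E₁) m ((t∈ , h∈) ∷ within) mv₂≡0 w≡ =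
        trans (cong₂ _-_ (term t t∈) (term h h∈))
              (factor (+ m v₁) (+ inside⁺ m t * mperm (inside⁺ m ⊖ t) E₁) (+ inside⁺ m h * mperm (inside⁺ m ⊖ h) E₁) (mperm (outside⁻ m) E₂))
        where
          factor : ∀ k a b c → k * (a * c) - k * (b * c) ≡ k * ((a - b) * c)
          factor = solve-∀
          zero-on-right : {a : ℕ} (X : ℤ) → a ≡ 0 → + 0 ≡ + m v₁ * ((+ a * X) * mperm (outside⁻ m) E₂)
          zero-on-right X a≡0 = sym (trans (cong (λ z → + m v₁ * (z * mperm (outside⁻ m) E₂)) (zero-coefficient X a≡0)) (ℤP.*-zeroʳ (+ m v₁)))
          term : (x : Fin n) → x ∈ V₁
            → + m x * mperm (m ⊖ x) (E₁ ++ E₂) ≡ + m v₁ * ((+ inside⁺ m x * mperm (inside⁺ m ⊖ x) E₁) * mperm (outside⁻ m) E₂)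
          term x x∈ with endpoint x x∈
          ... | at-v₂ refl = trans (zero-coefficient _ mv₂≡0) (zero-on-right _ (trans (onInterior-no v₂-exterior) (δ-diff v₁≢v₂)))
          ... | at-v₁ refl = begin
              + m v₁ * mperm (m ⊖ v₁) (E₁ ++ E₂)
            ≡⟨ cong (+ m v₁ *_) (split₀ E₁ (m ⊖ v₁) within (⊖-keeps-zero m v₁ v₂ mv₂≡0)
                                   (trans (weight-exterior m v₁ v₁-exterior) (ℕP.suc-injective w≡))) ⟩
              + m v₁ * (mperm (inside (m ⊖ v₁)) E₁ * mperm (outside (m ⊖ v₁)) E₂)
            ≡⟨ cong (+ m v₁ *_) (cong₂ _*_ (mperm-cong E₁ (inside-⊖v₁ m)) (mperm-cong E₂ (outside-⊖v₁ m))) ⟩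
              + m v₁ * (mperm (inside⁺ m ⊖ v₁) E₁ * mperm (outside⁻ m) E₂)
            ≡⟨ cong (λ z → + m v₁ * (z * mperm (outside⁻ m) E₂)) (sym (ℤP.*-identityˡ (mperm (inside⁺ m ⊖ v₁) E₁))) ⟩
              + m v₁ * ((+ 1 * mperm (inside⁺ m ⊖ v₁) E₁) * mperm (outside⁻ m) E₂)
            ≡⟨ cong (λ k → + m v₁ * ((+ k * mperm (inside⁺ m ⊖ v₁) E₁) * mperm (outside⁻ m) E₂))
                    (sym (trans (onInterior-no v₁-exterior) (δ-same v₁))) ⟩
              + m v₁ * ((+ inside⁺ m v₁ * mperm (inside⁺ m ⊖ v₁) E₁) * mperm (outside⁻ m) E₂)
            ∎
            where open ≡-Reasoning
          ... | interior int with m x ℕ.≟ 0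
          ...   | yes mx≡0 = trans (zero-coefficient _ mx≡0) (zero-on-right _ (trans (onInterior-yes int) mx≡0))
          ...   | no  mx≢0 = begin
              + m x * mperm (m ⊖ x) (E₁ ++ E₂)
            ≡⟨ cong (+ m x *_) (split₁ E₁ (m ⊖ x) within (⊖-keeps-zero m x v₂ mv₂≡0)
                                  (ℕP.suc-injective (trans (cong suc (weight-interior m x int mx≢0)) w≡))) ⟩
              + m x * (+ (m ⊖ x) v₁ * (mperm (inside⁺ (m ⊖ x)) E₁ * mperm (outside⁻ (m ⊖ x)) E₂))
            ≡⟨ cong (+ m x *_) (cong₂ (λ k z → + k * z) (⊖-other m (proj₁ (proj₂ int)))
                 (cong₂ _*_ (mperm-cong E₁ (λ u → inside⁺-⊖ m x u int)) (mperm-cong E₂ (λ u → outside⁻-⊖ m x u int)))) ⟩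
              + m x * (+ m v₁ * (mperm (inside⁺ m ⊖ x) E₁ * mperm (outside⁻ m) E₂))
            ≡⟨ rearrange (+ m x) (+ m v₁) _ _ ⟩
              + m v₁ * ((+ m x * mperm (inside⁺ m ⊖ x) E₁) * mperm (outside⁻ m) E₂)
            ≡⟨ cong (λ k → + m v₁ * ((+ k * mperm (inside⁺ m ⊖ x) E₁) * mperm (outside⁻ m) E₂)) (sym (onInterior-yes int)) ⟩
              + m v₁ * ((+ inside⁺ m x * mperm (inside⁺ m ⊖ x) E₁) * mperm (outside⁻ m) E₂)
            ∎
            where
              open ≡-Reasoning
              rearrange : ∀ a k b c → a * (k * (b * c)) ≡ k * ((a * b) * c)
              rearrange = solve-∀

    interiorList : List (Fin n)
    interiorList = without (without V₁ v₂) v₁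

    module _ (unique₁ : Unique V₁) (v₁∈ : v₁ ∈ V₁) (v₂∈ : v₂ ∈ V₁) where

      interiorList-length : suc (suc (length interiorList)) ≡ length V₁
      interiorList-length = trans (cong suc (without-length (without V₁ v₂) v₁ unique-without v₁∈without))
                                  (without-length V₁ v₂ unique₁ v₂∈)
        where
          unique-without : Unique (without V₁ v₂)
          unique-without = UniqueP.filter⁺ (λ v → ¬? (v ≟ v₂)) unique₁
          v₁∈without : v₁ ∈ without V₁ v₂
          v₁∈without = ∈-filter⁺ (λ v → ¬? (v ≟ v₂)) v₁∈ v₁≢v₂

      weight-double : (m : Fin n → ℕ) → (∀ u → Interior u → m u ≡ 2)
        → weight m ≡ length interiorList ℕ.+ length interiorList
      weight-double m double = begin
          ℕΣ.sum (inside m)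
        ≡⟨ ℕΣ.sum-cong-≗ (λ u → trans (inside≡ u) (sym (mult-++ interiorList interiorList u))) ⟩
          ℕΣ.sum (mult (interiorList ++ interiorList))
        ≡⟨ trans (∑ℕ-mult (interiorList ++ interiorList)) (LP.length-++ interiorList) ⟩
          length interiorList ℕ.+ length interiorList
        ∎
        where
          open ≡-Reasoning
          mult-interiorList : ∀ u → ¬ u ≡ v₁ → ¬ u ≡ v₂ → mult interiorList u ≡ mult V₁ u
          mult-interiorList u u≢v₁ u≢v₂ =
            trans (mult-without-other (without V₁ v₂) v₁ u u≢v₁) (mult-without-other V₁ v₂ u u≢v₂)
          outside-interiorList : ∀ u → ¬ Interior u → mult interiorList u ≡ 0
          outside-interiorList u ext with u ≟ v₁ | u ≟ v₂
          ... | yes refl | _        = mult-without-self (without V₁ v₂) u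
          ... | no u≢v₁  | yes refl = trans (mult-without-other (without V₁ u) v₁ u u≢v₁) (mult-without-self V₁ u)
          ... | no u≢v₁  | no u≢v₂  =
            trans (mult-interiorList u u≢v₁ u≢v₂) (mult-absent V₁ u (λ u∈ → ext (u∈ , u≢v₁ , u≢v₂)))
          inside≡ : ∀ u → inside m u ≡ mult interiorList u ℕ.+ mult interiorList u
          inside≡ u with interior? u
          ... | yes int@(u∈ , u≢v₁ , u≢v₂) =
            trans (double u int) (cong (λ k → k ℕ.+ k) (sym (trans (mult-interiorList u u≢v₁ u≢v₂) (mult-unique V₁ u unique₁ u∈))))
          ... | no  ext = cong (λ k → k ℕ.+ k) (sym (outside-interiorList u ext))

  cutPerm : List (Fin n) → List (Edge n) → Fin n → Fin n → ℤ
  cutPerm V E v₁ v₂ = mperm (dsiMult V v₂ ⊖ v₁) E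

  module CutSetting {n : ℕ} (V₁ V₂ : List (Fin n)) (E₁ E₂ : List (Edge n)) (v₁ v₂ : Fin n)
    (H₁ : IsLooplessGraph V₁ E₁) (H₂ : IsLooplessGraph V₂ E₂) (v₁≢v₂ : ¬ v₁ ≡ v₂)
    (cover : ∀ v → v ∈ V₁ ⊎ v ∈ V₂) (shared : ∀ v → (v ∈ V₁ × v ∈ V₂) ⇔ (v ≡ v₁ ⊎ v ≡ v₂)) where

    open TwoSum V₁ v₁ v₂ v₁≢v₂ E₂

    v₁∈ : v₁ ∈ V₁ × v₁ ∈ V₂
    v₁∈ = Equivalence.from (shared v₁) (inj₁ refl)

    v₂∈ : v₂ ∈ V₁ × v₂ ∈ V₂
    v₂∈ = Equivalence.from (shared v₂) (inj₂ refl)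

    unique₁ : Unique V₁
    unique₁ = IsLooplessGraph.uniqueV H₁

    unique₂ : Unique V₂
    unique₂ = IsLooplessGraph.uniqueV H₂

    mG : Fin n → ℕ
    mG = dsiMult (allFin n) v₂

    mG-double : ∀ u → ¬ u ≡ v₂ → mG u ≡ 2
    mG-double u u≢v₂ = dsiMult-member (allFin n) v₂ u (UniqueP.allFin⁺ n) (∈-allFin u) u≢v₂

    interior∉V₂ : ∀ u → Interior u → ¬ u ∈ V₂
    interior∉V₂ u (u∈₁ , u≢v₁ , u≢v₂) u∈₂ = [ u≢v₁ , u≢v₂ ]′ (Equivalence.to (shared u) (u∈₁ , u∈₂))

    interior-avoids : ∀ u → Interior u → Avoids u E₂
    interior-avoids u int = within-avoids V₂ E₂ u (graph-within H₂) (interior∉V₂ u int)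

    -- count₁ says |E₁| = 2·(|V₁| − 2) + 1: the interior twice and v₁ once
    weight-mG : 2 ℕ.* length V₁ ≡ length ((v₁ , v₂) ∷ E₁) ℕ.+ 2 → suc (weight mG) ≡ length E₁
    weight-mG count₁ =
      trans (cong suc (weight-double unique₁ (proj₁ v₁∈) (proj₁ v₂∈) mG (λ u (_ , _ , u≢v₂) → mG-double u u≢v₂)))
            (odd (length interiorList) (length E₁) (trans (cong (2 ℕ.*_) (interiorList-length unique₁ (proj₁ v₁∈) (proj₁ v₂∈))) count₁))
      where
        odd : ∀ a e → 2 ℕ.* suc (suc a) ≡ suc e ℕ.+ 2 → suc (a ℕ.+ a) ≡ e
        odd a e eq = ℕP.+-cancelˡ-≡ 3 _ _ (trans (doubled a) (trans eq (ℕP.+-comm (suc e) 2)))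
          where
            doubled : ∀ a → 3 ℕ.+ suc (a ℕ.+ a) ≡ 2 ℕ.* suc (suc a)
            doubled = ℕSolver.solve-∀

    inside⁺-mG : ∀ u → inside⁺ mG u ≡ (dsiMult V₁ v₂ ⊖ v₁) u
    inside⁺-mG u with interior? u
    ... | yes (u∈₁ , u≢v₁ , u≢v₂) = trans (mG-double u u≢v₂)
                                      (sym (trans (⊖-other (dsiMult V₁ v₂) (≢-sym u≢v₁)) (dsiMult-member V₁ v₂ u unique₁ u∈₁ u≢v₂)))
    ... | no  ext with u ≟ v₁ | u ≟ v₂
    ...   | yes refl | _        = trans (δ-same u)
                                    (sym (trans (cong (ℕ._∸ δ u u) (dsiMult-member V₁ v₂ u unique₁ (proj₁ v₁∈) v₁≢v₂)) (cong (2 ℕ.∸_) (δ-same u))))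
    ...   | no u≢v₁  | yes refl = trans (δ-diff (≢-sym u≢v₁)) (sym (⊖-keeps-zero (dsiMult V₁ u) v₁ u (dsiMult-special V₁ u)))
    ...   | no u≢v₁  | no u≢v₂  = trans (δ-diff (≢-sym u≢v₁))
                                    (sym (⊖-keeps-zero (dsiMult V₁ v₂) v₁ u (dsiMult-absent V₁ v₂ u (λ u∈₁ → ext (u∈₁ , u≢v₁ , u≢v₂)))))

    outside⁻-mG : ∀ u → outside⁻ mG u ≡ (dsiMult V₂ v₂ ⊖ v₁) u
    outside⁻-mG u with interior? u
    ... | yes int = sym (⊖-keeps-zero (dsiMult V₂ v₂) v₁ u (dsiMult-absent V₂ v₂ u (interior∉V₂ u int)))
    ... | no  ext = cong (ℕ._∸ δ v₁ u) (same-rows (u ≟ v₂))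
      where
        same-rows : Dec (u ≡ v₂) → mG u ≡ dsiMult V₂ v₂ u
        same-rows (yes refl)  = trans (dsiMult-special (allFin n) u) (sym (dsiMult-special V₂ u))
        same-rows (no u≢v₂) with u ≟ v₁ | cover u
        ... | yes refl | _        = trans (mG-double u u≢v₂) (sym (dsiMult-member V₂ v₂ u unique₂ (proj₂ v₁∈) u≢v₂))
        ... | no u≢v₁  | inj₁ u∈₁ = ⊥-elim (ext (u∈₁ , u≢v₁ , u≢v₂))
        ... | no _     | inj₂ u∈₂ = trans (mG-double u u≢v₂) (sym (dsiMult-member V₂ v₂ u unique₂ u∈₂ u≢v₂))

    factorisation : 2 ℕ.* length V₁ ≡ length ((v₁ , v₂) ∷ E₁) ℕ.+ 2
      → mperm mG (E₁ ++ E₂) ≡ + 2 * (cutPerm V₁ E₁ v₁ v₂ * cutPerm V₂ E₂ v₁ v₂)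
    factorisation count₁ = begin
        mperm mG (E₁ ++ E₂)
      ≡⟨ split₁ interior-avoids E₁ mG (graph-within H₁) (dsiMult-special (allFin n) v₂) (weight-mG count₁) ⟩
        + mG v₁ * (mperm (inside⁺ mG) E₁ * mperm (outside⁻ mG) E₂)
      ≡⟨ cong₂ (λ k z → + k * z) (mG-double v₁ v₁≢v₂) (cong₂ _*_ (mperm-cong E₁ inside⁺-mG) (mperm-cong E₂ outside⁻-mG)) ⟩
        + 2 * (cutPerm V₁ E₁ v₁ v₂ * cutPerm V₂ E₂ v₁ v₂)
      ∎
      where open ≡-Reasoning

  -- For G = H + v₁v₂ with special vertex v₂, the new first column can only
  -- be matched with one of the two v₁ rows.
  graphPermanent-with-edge : (V : List (Fin n)) (E : List (Edge n)) (v₁ v₂ s : Fin n) → IsLooplessGraph V E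
    → ¬ v₁ ≡ v₂ → v₁ ∈ V → v₂ ∈ V → 2 ℕ.* length V ≡ length ((v₁ , v₂) ∷ E) ℕ.+ 2 → s ∈ V
    → graphPermanent V ((v₁ , v₂) ∷ E) s ≡ residue (+ 2 * cutPerm V E v₁ v₂)
  graphPermanent-with-edge V E v₁ v₂ s H v₁≢v₂ v₁∈ v₂∈ count s∈ = begin
      graphPermanent V ((v₁ , v₂) ∷ E) s
    ≡⟨ graphPermanent-at V ((v₁ , v₂) ∷ E) s v₂ (add-edge V E v₁ v₂ H v₁∈ v₂∈ v₁≢v₂) count s∈ v₂∈ ⟩
      residue (+ M v₁ * mperm (M ⊖ v₁) E - + M v₂ * mperm (M ⊖ v₂) E)
    ≡⟨ cong residue (cong₂ (λ a b → + a * cutPerm V E v₁ v₂ - + b * mperm (M ⊖ v₂) E)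
                           (dsiMult-member V v₂ v₁ (IsLooplessGraph.uniqueV H) v₁∈ v₁≢v₂) (dsiMult-special V v₂)) ⟩
      residue (+ 2 * cutPerm V E v₁ v₂ - + 0 * mperm (M ⊖ v₂) E)
    ≡⟨ cong residue (drop-zero (cutPerm V E v₁ v₂) (mperm (M ⊖ v₂) E)) ⟩
      residue (+ 2 * cutPerm V E v₁ v₂)
    ∎
    where
      open ≡-Reasoning
      M : Fin _ → ℕ
      M = dsiMult V v₂
      drop-zero : ∀ x y → + 2 * x - + 0 * y ≡ + 2 * x
      drop-zero = solve-∀

open import Data.Nat using (_+_; _*_)
open import Data.Integer as ℤ using (+_)

theorem4p8 : (n : ℕ) (V₁ V₂ : List (Fin n)) (E₁ E₂ : List (Edge n)) (v₁ v₂ : Fin n)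
    → IsLooplessGraph V₁ E₁ → IsLooplessGraph V₂ E₂
    → ¬ (v₁ ≡ v₂)
    → (∀ v → v ∈ V₁ ⊎ v ∈ V₂)
    → (∀ v → (v ∈ V₁ × v ∈ V₂) ⇔ (v ≡ v₁ ⊎ v ≡ v₂))
    → Connected (allFin n) (E₁ ++ E₂)
    → Connected V₁ ((v₁ , v₂) ∷ E₁)
    → Connected V₂ ((v₁ , v₂) ∷ E₂)
    → 2 * n ≡ length (E₁ ++ E₂) + 2
    → 2 * length V₁ ≡ length ((v₁ , v₂) ∷ E₁) + 2
    → 2 * length V₂ ≡ length ((v₁ , v₂) ∷ E₂) + 2
    → (s : Fin n) (s₁ : Fin n) (s₂ : Fin n) → s₁ ∈ V₁ → s₂ ∈ V₂
    → graphPermanent (allFin n) (E₁ ++ E₂) s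
      ≡ graphPermanent V₁ ((v₁ , v₂) ∷ E₁) s₁ * graphPermanent V₂ ((v₁ , v₂) ∷ E₂) s₂
theorem4p8 n V₁ V₂ E₁ E₂ v₁ v₂ H₁ H₂ v₁≢v₂ cover shared _ _ _ count count₁ count₂ s s₁ s₂ s₁∈ s₂∈ = begin
    graphPermanent (allFin n) (E₁ ++ E₂) s
  ≡⟨ graphPermanent-at (allFin n) (E₁ ++ E₂) s v₂ (union-complete V₁ V₂ E₁ E₂ H₁ H₂) count-G (∈-allFin s) (∈-allFin v₂) ⟩
    residue (mperm mG (E₁ ++ E₂))
  ≡⟨ cong residue (factorisation count₁) ⟩
    residue (+ 2 ℤ.* (A ℤ.* B))
  ≡⟨ residue-double-product A B ⟩
    residue (+ 2 ℤ.* A) * residue (+ 2 ℤ.* B)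
  ≡⟨ sym (cong₂ _*_ (graphPermanent-with-edge V₁ E₁ v₁ v₂ s₁ H₁ v₁≢v₂ (proj₁ v₁∈) (proj₁ v₂∈) count₁ s₁∈)
                    (graphPermanent-with-edge V₂ E₂ v₁ v₂ s₂ H₂ v₁≢v₂ (proj₂ v₁∈) (proj₂ v₂∈) count₂ s₂∈)) ⟩
    graphPermanent V₁ ((v₁ , v₂) ∷ E₁) s₁ * graphPermanent V₂ ((v₁ , v₂) ∷ E₂) s₂
  ∎
  where
    open ≡-Reasoning
    open CutSetting V₁ V₂ E₁ E₂ v₁ v₂ H₁ H₂ v₁≢v₂ cover shared using (mG; v₁∈; v₂∈; factorisation)
    A B : ℤ.ℤ
    A = cutPerm V₁ E₁ v₁ v₂
    B = cutPerm V₂ E₂ v₁ v₂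
    count-G : 2 * length (allFin n) ≡ length (E₁ ++ E₂) + 2
    count-G = trans (cong (2 *_) (LP.length-tabulate {n = n} (λ x → x))) count
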